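{- Let $G$ be a complete graph with $n$ vertices and $f_t$ a token-placement of $G$. For any two adjacent token-placements $f$ and $f'$ of $G$ for which $\Phi(f,f_t)$ is defined, $\Phi(f',f_t)\ge\Phi(f,f_t)-1$.
   Context: Colors are $\{1,\dots,c\}$; a token-placement of $G=(V,E)$ is a surjective map $V\to\{1,\dots,c\}$. Two token-placements are adjacent if one is obtained from the other by exchanging the values on the two endpoints of a single edge. For token-placements $f,g$, the destination graph $D(f,g)$ is the directed graph on $V$ with an arc $(u,v)$ (self-loops allowed) iff $f(u)=g(v)$. A cycle cover of $D(f,g)$ is a set of vertex-disjoint directed cycles (self-loops count as one-vertex cycles) covering all vertices; it is optimal if it has the maximum number of cycles. Such a cover exists exactly when each color is used by the same number of vertices under $f$ and $g$. The potential is $\Phi(f,g)=n-|\mathcal{C}^*(f,g)|$, where $\mathcal{C}^*(f,g)$ is an optimal cycle cover of $D(f,g)$. -}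

module Defs where

open import Data.Nat using (ℕ; zero; suc; _≤_; _∸_)
open import Data.Nat.Properties using (_≤?_)
open import Data.Fin using (Fin; toℕ)
open import Data.Fin.Permutation using (Permutation′; _⟨$⟩ʳ_)
open import Data.List using (List; length; filter; upTo; allFin)
open import Data.List.Relation.Unary.All using (All; all?)
open import Data.Product using (Σ; _×_; ∃)
open import Function.Definitions using (Surjective)
open import Relation.Binary.PropositionalEquality using (_≡_; _≢_)
open import Relation.Nullary using (Dec)

-- Vertices of G are Fin n; colours {1,…,c} are represented by Fin c.

IsTokenPlacement : ∀ {n c} → (Fin n → Fin c) → Set
IsTokenPlacement f = Surjective _≡_ _≡_ f

-- Adjacency of token-placements in the complete graph K_n:
-- every pair of distinct vertices u ≠ v is an edge, and f' is f with the
-- values on u and v exchanged.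
Adjacent : ∀ {n c} → (Fin n → Fin c) → (Fin n → Fin c) → Set
Adjacent {n} f f' =
  Σ (Fin n) λ u → Σ (Fin n) λ v →
    u ≢ v × f' u ≡ f v × f' v ≡ f u ×
    (∀ w → w ≢ u → w ≢ v → f' w ≡ f w)

-- A cycle cover of the destination graph D(f,g) (arc (u,w) iff f u ≡ g w)
-- is the same as a permutation σ of V using only arcs u → σ u
-- (the cycles of the cover are the cycles of σ).
IsCycleCover : ∀ {n c} → (Fin n → Fin c) → (Fin n → Fin c) → Permutation′ n → Set
IsCycleCover {n} f g σ = ∀ (u : Fin n) → f u ≡ g (σ ⟨$⟩ʳ u)

iter : ∀ {n} → Permutation′ n → ℕ → Fin n → Fin n
iter σ zero    u = u
iter σ (suc k) u = σ ⟨$⟩ʳ (iter σ k u)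

-- u is the representative (least element) of its cycle under σ.
-- Every orbit of a permutation of Fin n is {σ^k u | k < n}.
IsCycleRep : ∀ {n} → Permutation′ n → Fin n → Set
IsCycleRep {n} σ u = All (λ k → toℕ u ≤ toℕ (iter σ k u)) (upTo n)

isCycleRep? : ∀ {n} (σ : Permutation′ n) (u : Fin n) → Dec (IsCycleRep σ u)
isCycleRep? σ u = all? (λ k → toℕ u ≤? toℕ (iter σ k u)) _

-- Number of cycles of σ (= number of cycles of the corresponding cover,
-- fixed points counting as one-vertex cycles).
numCycles : ∀ {n} → Permutation′ n → ℕ
numCycles σ = length (filter (isCycleRep? σ) (allFin _))

IsOptimalCover : ∀ {n c} → (Fin n → Fin c) → (Fin n → Fin c) → Permutation′ n → Set
IsOptimalCover f g σ =
  IsCycleCover f g σ × (∀ τ → IsCycleCover f g τ → numCycles τ ≤ numCycles σ)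

PhiDefined : ∀ {n c} → (Fin n → Fin c) → (Fin n → Fin c) → Set
PhiDefined f g = ∃ λ σ → IsCycleCover f g σ

PhiIs : ∀ {n c} → (Fin n → Fin c) → (Fin n → Fin c) → ℕ → Set
PhiIs {n} f g k = ∃ λ σ → IsOptimalCover f g σ × k ≡ n ∸ numCycles σ

module Submission where

-- Let σ and σ′ be optimal cycle covers of D(f, f_t) and D(f′, f_t), where f′ is f with the
-- tokens on u and v exchanged. Precomposing σ′ with the transposition (u v) gives a cycle
-- cover τ of D(f, f_t) that agrees with σ′ outside {u, v}. Changing a permutation at two
-- points destroys at most one cycle: the cycles of σ′ through neither u nor v are cycles of
-- τ, at most two cycles of σ′ meet {u, v}, and the cycle of τ through u is not among the
-- former. Hence |σ′| ≤ |τ| + 1 ≤ |σ| + 1, that is Φ(f′, f_t) ≥ Φ(f, f_t) − 1. That Φ(f′, f_t)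
-- is defined at all is a finite maximisation of the number of cycles over the covers of
-- D(f′, f_t), one of which is obtained from a cover of D(f, f_t) by the same transposition.

open import Defs
open import Data.Nat using (ℕ; zero; suc; _+_; _*_; _∸_; _≤_; _<_; z≤n; s≤s; s≤s⁻¹)
open import Data.Nat.Properties
  using (≤-refl; ≤-reflexive; ≤-trans; ≤-antisym; <-trans; n<1+n; n≤1+n; m≤n⇒m≤1+n; m<n⇒m<1+n;
         m≤n+m; m≤n⇒∃[o]m+o≡n; +-comm; +-suc; *-suc; +-mono-≤; +-monoʳ-≤; ∸-+-assoc; ∸-monoʳ-≤; module ≤-Reasoning)
open import Data.Nat.DivMod using (_%_; _/_; m≡m%n+[m/n]*n; m%n<n)
open import Data.Fin using (Fin; toℕ)
open import Data.Fin.Properties using (_≟_; all?; toℕ-injective; toℕ≤pred[n]; pigeonhole)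
open import Data.Fin.Permutation
  using (Permutation′; _⟨$⟩ʳ_; _⟨$⟩ˡ_; inverseˡ; inverseʳ; permutation; _≈_; transpose; _∘ₚ_)
import Data.Fin.Permutation.Components as PC
open import Data.List using (List; []; _∷_; length; filter; upTo; allFin; cartesianProduct; cartesianProductWith)
open import Data.List.Properties using (filter-accept; filter-reject; filter-none; filter-≐)
open import Data.List.Extrema.Nat using (argmin; f[argmin]≤f[xs]; argmax; f[xs]≤f[argmax])
open import Data.List.Membership.Propositional using (_∈_)
open import Data.List.Membership.Propositional.Properties using (∈-allFin; ∈-cartesianProductWith⁺; ∈-cartesianProduct⁺)
import Data.List.Relation.Unary.All as All
open import Data.List.Relation.Unary.All.Properties using (applyUpTo⁺₁; applyUpTo⁻)
open import Data.List.Relation.Unary.Any using (Any; here; there; satisfied; any?)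
import Data.List.Relation.Unary.Any.Properties as Any
open import Data.List.Relation.Unary.AllPairs using (_∷_)
open import Data.List.Relation.Unary.Unique.Propositional using (Unique)
open import Data.List.Relation.Unary.Unique.Propositional.Properties using (allFin⁺)
import Data.List.Relation.Binary.Sublist.Propositional as Sublist
import Data.List.Relation.Binary.Sublist.Propositional.Properties as Sublist
open import Data.Vec using (Vec; []; _∷_; lookup; tabulate)
open import Data.Vec.Properties using (lookup∘tabulate)
open import Data.Product using (Σ; _×_; _,_; proj₁; proj₂; ∃)
open import Data.Sum using (inj₁; inj₂)
open import Function using (_∘_)
open import Function.Bundles using (Injection)
open import Function.Definitions using (StrictlyInverseˡ; StrictlyInverseʳ)
open import Function.Properties.Inverse using (↔⇒↣)
open import Level using (Level; 0ℓ)
open import Relation.Binary.Definitions using (_Respects_)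
open import Relation.Binary.PropositionalEquality
open import Relation.Nullary using (¬_; yes; no; contradiction; _×-dec_)
open import Relation.Unary using (Pred; Decidable; _⊆_; _∪_; _∩_; ∁)
open import Relation.Unary.Properties using (_∪?_; _∩?_; ∁?)

private
  variable
    ℓ ℓ′ ℓ″ : Level
    A : Set ℓ

count : {P : Pred A ℓ′} → Decidable P → List A → ℕ
count P? xs = length (filter P? xs)

module _ {P : Pred A ℓ′} {Q : Pred A ℓ″} (P? : Decidable P) (Q? : Decidable Q) where

  count-mono : P ⊆ Q → ∀ xs → count P? xs ≤ count Q? xs
  count-mono P⊆Q xs = Sublist.length-mono-≤ (Sublist.filter⁺ P? Q? (λ { refl → P⊆Q }) (Sublist.⊆-refl {x = xs}))

  count-mono-< : P ⊆ Q → ∀ {x xs} → x ∈ xs → Q x → ¬ P x → count P? xs < count Q? xs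
  count-mono-< P⊆Q {xs = x ∷ xs} (here refl) Qx ¬Px
    rewrite filter-reject P? {xs = xs} ¬Px | filter-accept Q? {xs = xs} Qx = s≤s (count-mono P⊆Q xs)
  count-mono-< P⊆Q {xs = y ∷ xs} (there x∈xs) Qx ¬Px with P? y | Q? y
  ... | yes Py | yes _  = s≤s (count-mono-< P⊆Q x∈xs Qx ¬Px)
  ... | yes Py | no ¬Qy = contradiction (P⊆Q Py) ¬Qy
  ... | no _   | yes _  = m≤n⇒m≤1+n (count-mono-< P⊆Q x∈xs Qx ¬Px)
  ... | no _   | no _   = count-mono-< P⊆Q x∈xs Qx ¬Px

  count-∪ : ∀ xs → count (P? ∪? Q?) xs ≤ count P? xs + count Q? xs
  count-∪ [] = z≤n
  count-∪ (x ∷ xs) with P? x | Q? x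
  ... | yes _ | yes _ = s≤s (≤-trans (count-∪ xs) (+-monoʳ-≤ (count P? xs) (n≤1+n _)))
  ... | yes _ | no _  = s≤s (count-∪ xs)
  ... | no _  | yes _ = ≤-trans (s≤s (count-∪ xs)) (≤-reflexive (sym (+-suc _ _)))
  ... | no _  | no _  = count-∪ xs

count-≤1 : {P : Pred A ℓ′} (P? : Decidable P) → (∀ {x y} → P x → P y → x ≡ y) →
           ∀ {xs} → Unique xs → count P? xs ≤ 1
count-≤1 P? P-unique {[]} _ = z≤n
count-≤1 P? P-unique {x ∷ xs} (x∉xs ∷ xs!) with P? x
... | yes Px = s≤s (≤-reflexive (cong length (filter-none P? (All.map (λ x≢y Py → x≢y (P-unique Px Py)) x∉xs))))
... | no _   = count-≤1 P? P-unique xs!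

module _ {n : ℕ} (σ : Permutation′ n) where

  iter-+ : ∀ a b x → iter σ (a + b) x ≡ iter σ a (iter σ b x)
  iter-+ zero    b x = refl
  iter-+ (suc a) b x = cong (σ ⟨$⟩ʳ_) (iter-+ a b x)

  iter-injective : ∀ a {x y} → iter σ a x ≡ iter σ a y → x ≡ y
  iter-injective zero    e = e
  iter-injective (suc a) e = iter-injective a (Injection.injective (↔⇒↣ σ) e)

  period : ∀ x → ∃ λ p → suc p ≤ n × iter σ (suc p) x ≡ x
  period x with i , j , i<j , eq ← pigeonhole (n<1+n n) (λ i → iter σ (toℕ i) x)
             with p , i+p≡j ← m≤n⇒∃[o]m+o≡n i<j = p , p<n , iter-injective (toℕ i) (begin
      iter σ (toℕ i) (iter σ (suc p) x) ≡⟨ iter-+ (toℕ i) (suc p) x ⟨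
      iter σ (toℕ i + suc p) x          ≡⟨ cong (λ k → iter σ k x) (trans (+-suc (toℕ i) p) i+p≡j) ⟩
      iter σ (toℕ j) x                  ≡⟨ eq ⟨
      iter σ (toℕ i) x                  ∎)
    where
      open ≡-Reasoning
      p<n : suc p ≤ n
      p<n = ≤-trans (s≤s (m≤n+m p (toℕ i))) (≤-trans (≤-reflexive i+p≡j) (toℕ≤pred[n] j))

  iter-*-period : ∀ {p x} → iter σ (suc p) x ≡ x → ∀ q → iter σ (q * suc p) x ≡ x
  iter-*-period         e zero    = refl
  iter-*-period {p} {x} e (suc q) =
    trans (iter-+ (suc p) (q * suc p) x) (trans (cong (iter σ (suc p)) (iter-*-period e q)) e)

  iter-reduce : ∀ k x → ∃ λ j → j < n × iter σ k x ≡ iter σ j x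
  iter-reduce k x with p , p<n , e ← period x =
    k % suc p , ≤-trans (m%n<n k (suc p)) p<n , (begin
      iter σ k x                                          ≡⟨ cong (λ m → iter σ m x) (m≡m%n+[m/n]*n k (suc p)) ⟩
      iter σ (k % suc p + k / suc p * suc p) x            ≡⟨ iter-+ (k % suc p) (k / suc p * suc p) x ⟩
      iter σ (k % suc p) (iter σ (k / suc p * suc p) x)   ≡⟨ cong (iter σ (k % suc p)) (iter-*-period e (k / suc p)) ⟩
      iter σ (k % suc p) x                                ∎)
    where open ≡-Reasoning

  iter-return : ∀ a {x y} → iter σ a x ≡ y → ∃ λ b → b < n × iter σ b y ≡ x
  iter-return a {x} {y} refl with p , _ , e ← period x with j , j<n , e′ ← iter-reduce (a * p) y =
    j , j<n , (begin
      iter σ j y                   ≡⟨ e′ ⟨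
      iter σ (a * p) (iter σ a x)  ≡⟨ iter-+ (a * p) a x ⟨
      iter σ (a * p + a) x         ≡⟨ cong (λ m → iter σ m x) (trans (+-comm (a * p) a) (sym (*-suc a p))) ⟩
      iter σ (a * suc p) x         ≡⟨ iter-*-period e a ⟩
      x                            ∎)
    where open ≡-Reasoning

  isCycleRep⁺ : ∀ {w} → (∀ {k} → k < n → toℕ w ≤ toℕ (iter σ k w)) → IsCycleRep σ w
  isCycleRep⁺ = applyUpTo⁺₁ _ n

  isCycleRep⁻ : ∀ {w} → IsCycleRep σ w → ∀ {k} → k < n → toℕ w ≤ toℕ (iter σ k w)
  isCycleRep⁻ = applyUpTo⁻ _ n

  cycleRep-≤ : ∀ {w₁ w₂} a b → IsCycleRep σ w₁ → iter σ a w₁ ≡ iter σ b w₂ → toℕ w₁ ≤ toℕ w₂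
  cycleRep-≤ {w₁} a b rep e with c , _ , e′ ← iter-return b (sym e)
                            with j , j<n , e″ ← iter-reduce (c + a) w₁ =
    subst (λ y → toℕ w₁ ≤ toℕ y) (trans (sym e″) (trans (iter-+ c a w₁) e′)) (isCycleRep⁻ rep j<n)

  cycleRep-unique : ∀ {w₁ w₂} a b → IsCycleRep σ w₁ → IsCycleRep σ w₂ →
                    iter σ a w₁ ≡ iter σ b w₂ → w₁ ≡ w₂
  cycleRep-unique a b rep₁ rep₂ e =
    toℕ-injective (≤-antisym (cycleRep-≤ a b rep₁ e) (cycleRep-≤ b a rep₂ (sym e)))

  cycleRep-exists : ∀ x → ∃ λ r → IsCycleRep σ r × ∃ λ b → b < n × iter σ b r ≡ x
  cycleRep-exists x = r , isCycleRep⁺ r-minimal , iter-return a refl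
    where
      height : ℕ → ℕ
      height k = toℕ (iter σ k x)
      a : ℕ
      a = argmin height 0 (upTo n)
      r : Fin n
      r = iter σ a x
      r-minimal : ∀ {k} → k < n → toℕ r ≤ toℕ (iter σ k r)
      r-minimal {k} _ with j , j<n , e ← iter-reduce (k + a) x =
        subst (λ y → toℕ r ≤ toℕ y) (trans (sym e) (iter-+ k a x))
              (applyUpTo⁻ _ n (f[argmin]≤f[xs] {f = height} 0 (upTo n)) j<n)

iter-agree : ∀ {n} (ρ τ : Permutation′ n) {w} k →
             (∀ {j} → j < k → τ ⟨$⟩ʳ iter ρ j w ≡ ρ ⟨$⟩ʳ iter ρ j w) → iter τ k w ≡ iter ρ k w
iter-agree ρ τ zero    agree = refl
iter-agree ρ τ (suc k) agree =
  trans (cong (τ ⟨$⟩ʳ_) (iter-agree ρ τ k (λ j<k → agree (m<n⇒m<1+n j<k)))) (agree ≤-refl)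

IsCycleRep-resp : ∀ {n} {ρ τ : Permutation′ n} → ρ ≈ τ → ∀ {w} → IsCycleRep ρ w → IsCycleRep τ w
IsCycleRep-resp {ρ = ρ} {τ} ρ≈τ {w} = All.map λ {k} →
  subst (λ y → toℕ w ≤ toℕ y) (sym (iter-agree ρ τ k (λ _ → sym (ρ≈τ _))))

numCycles-cong : ∀ {n} {ρ τ : Permutation′ n} → ρ ≈ τ → numCycles ρ ≡ numCycles τ
numCycles-cong {n} {ρ} {τ} ρ≈τ = cong length
  (filter-≐ (isCycleRep? ρ) (isCycleRep? τ) (IsCycleRep-resp ρ≈τ , IsCycleRep-resp (sym ∘ ρ≈τ)) (allFin n))

Visits : ∀ {n} → Permutation′ n → Fin n → Pred (Fin n) 0ℓ
Visits {n} σ z w = Any (λ k → iter σ k w ≡ z) (upTo n)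

visits? : ∀ {n} (σ : Permutation′ n) z → Decidable (Visits σ z)
visits? σ z w = any? (λ k → iter σ k w ≟ z) _

AgreeOutside : ∀ {n} → Fin n → Fin n → Permutation′ n → Permutation′ n → Set
AgreeOutside u v ρ τ = ∀ x → x ≢ u → x ≢ v → τ ⟨$⟩ʳ x ≡ ρ ⟨$⟩ʳ x

module _ {n} {u v : Fin n} {ρ τ : Permutation′ n} (agree : AgreeOutside u v ρ τ) where

  private
    Avoiding : Pred (Fin n) 0ℓ
    Avoiding = IsCycleRep ρ ∩ (∁ (Visits ρ u) ∩ ∁ (Visits ρ v))

    avoiding? : Decidable Avoiding
    avoiding? = isCycleRep? ρ ∩? (∁? (visits? ρ u) ∩? ∁? (visits? ρ v))

    RepVisiting : Fin n → Pred (Fin n) 0ℓ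
    RepVisiting z = IsCycleRep ρ ∩ Visits ρ z

    repVisiting? : ∀ z → Decidable (RepVisiting z)
    repVisiting? z = isCycleRep? ρ ∩? visits? ρ z

    classify : IsCycleRep ρ ⊆ Avoiding ∪ (RepVisiting u ∪ RepVisiting v)
    classify {w} rep with visits? ρ u w | visits? ρ v w
    ... | yes visits-u | _            = inj₂ (inj₁ (rep , visits-u))
    ... | no _         | yes visits-v = inj₂ (inj₂ (rep , visits-v))
    ... | no ¬visits-u | no ¬visits-v = inj₁ (rep , ¬visits-u , ¬visits-v)

    repVisiting-unique : ∀ z {w₁ w₂} → RepVisiting z w₁ → RepVisiting z w₂ → w₁ ≡ w₂
    repVisiting-unique z (rep₁ , visits₁) (rep₂ , visits₂)
      with k₁ , e₁ ← satisfied visits₁ | k₂ , e₂ ← satisfied visits₂ =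
      cycleRep-unique ρ k₁ k₂ rep₁ rep₂ (trans e₁ (sym e₂))

    iter-agree-avoiding : ∀ {w} → Avoiding w → ∀ {k} → k < n → iter τ k w ≡ iter ρ k w
    iter-agree-avoiding (_ , ¬visits-u , ¬visits-v) {k} k<n = iter-agree ρ τ k λ j<k →
      let j<n = <-trans j<k k<n in
      agree _ (¬visits-u ∘ λ e → Any.applyUpTo⁺ _ e j<n) (¬visits-v ∘ λ e → Any.applyUpTo⁺ _ e j<n)

    avoiding⊆cycleRepτ : Avoiding ⊆ IsCycleRep τ
    avoiding⊆cycleRepτ {w} av@(rep , _) = isCycleRep⁺ τ λ k<n →
      subst (λ y → toℕ w ≤ toℕ y) (sym (iter-agree-avoiding av k<n)) (isCycleRep⁻ ρ rep k<n)

    count-visiting≤2 : count (repVisiting? u ∪? repVisiting? v) (allFin n) ≤ 2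
    count-visiting≤2 = ≤-trans (count-∪ (repVisiting? u) (repVisiting? v) (allFin n))
      (+-mono-≤ (count-≤1 (repVisiting? u) (repVisiting-unique u) (allFin⁺ n))
                (count-≤1 (repVisiting? v) (repVisiting-unique v) (allFin⁺ n)))

    count-avoiding< : count avoiding? (allFin n) < numCycles τ
    count-avoiding< with r , rep-r , b , b<n , e ← cycleRep-exists τ u =
      count-mono-< avoiding? (isCycleRep? τ) avoiding⊆cycleRepτ (∈-allFin r) rep-r r-not-avoiding
      where
        r-not-avoiding : ¬ Avoiding r
        r-not-avoiding av@(_ , ¬visits-u , _) =
          ¬visits-u (Any.applyUpTo⁺ _ (trans (sym (iter-agree-avoiding av b<n)) e) b<n)

  AgreeOutside⇒numCycles≤suc : numCycles ρ ≤ suc (numCycles τ)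
  AgreeOutside⇒numCycles≤suc = begin
    numCycles ρ
      ≤⟨ count-mono (isCycleRep? ρ) (avoiding? ∪? (repVisiting? u ∪? repVisiting? v)) classify (allFin n) ⟩
    count (avoiding? ∪? (repVisiting? u ∪? repVisiting? v)) (allFin n)
      ≤⟨ count-∪ avoiding? _ (allFin n) ⟩
    count avoiding? (allFin n) + count (repVisiting? u ∪? repVisiting? v) (allFin n)
      ≤⟨ +-monoʳ-≤ (count avoiding? (allFin n)) count-visiting≤2 ⟩
    count avoiding? (allFin n) + 2
      ≡⟨ +-comm (count avoiding? (allFin n)) 2 ⟩
    suc (suc (count avoiding? (allFin n)))
      ≤⟨ s≤s count-avoiding< ⟩
    suc (numCycles τ) ∎
    where open ≤-Reasoning

vectors : List A → ∀ k → List (Vec A k)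
vectors xs zero    = [] ∷ []
vectors xs (suc k) = cartesianProductWith _∷_ xs (vectors xs k)

∈-vectors : ∀ {xs : List A} → (∀ x → x ∈ xs) → ∀ {k} (v : Vec A k) → v ∈ vectors xs k
∈-vectors complete []      = here refl
∈-vectors complete (x ∷ v) = ∈-cartesianProductWith⁺ _∷_ (complete x) (∈-vectors complete v)

module _ {n} (P : Pred (Permutation′ n) 0ℓ) (P? : Decidable P) (P-resp : P Respects _≈_) where

  -- A permutation is coded by the tables of σ and σ⁻¹; there are finitely many codes. Codes
  -- of non-permutations and of permutations outside P score 0, the others 1 + numCycles.
  private
    Code : Set
    Code = Vec (Fin n) n × Vec (Fin n) n

    IsPermutationCode : Pred Code 0ℓ
    IsPermutationCode (ts , fs) =
      StrictlyInverseˡ _≡_ (lookup ts) (lookup fs) × StrictlyInverseʳ _≡_ (lookup ts) (lookup fs)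

    isPermutationCode? : Decidable IsPermutationCode
    isPermutationCode? (ts , fs) =
      all? (λ y → lookup ts (lookup fs y) ≟ y) ×-dec all? (λ x → lookup fs (lookup ts x) ≟ x)

    decode : ∀ c → IsPermutationCode c → Permutation′ n
    decode (ts , fs) (inverseˡ′ , inverseʳ′) = permutation (lookup ts) (lookup fs) inverseˡ′ inverseʳ′

    encode : Permutation′ n → Code
    encode σ = tabulate (σ ⟨$⟩ʳ_) , tabulate (σ ⟨$⟩ˡ_)

    Valid : Pred Code 0ℓ
    Valid c = Σ (IsPermutationCode c) (P ∘ decode c)

    valid? : Decidable Valid
    valid? c with isPermutationCode? c
    ... | no ¬code = no (¬code ∘ proj₁)
    ... | yes code with P? (decode c code)
    ...   | yes Pσ = yes (code , Pσ)
    ...   | no ¬Pσ = no λ (_ , Pσ) → ¬Pσ (P-resp (λ _ → refl) Pσ)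

    score : Code → ℕ
    score c with valid? c
    ... | yes (code , _) = suc (numCycles (decode c code))
    ... | no _           = 0

    score-valid : ∀ c (v : Valid c) → score c ≡ suc (numCycles (decode c (proj₁ v)))
    score-valid c v with valid? c
    ... | yes (code , _) = cong suc (numCycles-cong {ρ = decode c code} {τ = decode c (proj₁ v)} (λ _ → refl))
    ... | no ¬v          = contradiction v ¬v

    valid-score : ∀ c → 0 < score c → Valid c
    valid-score c pos with valid? c
    ... | yes v = v
    ... | no _  = contradiction pos λ ()

    lookup-encodeʳ : ∀ σ x → lookup (proj₁ (encode σ)) x ≡ σ ⟨$⟩ʳ x
    lookup-encodeʳ σ = lookup∘tabulate (σ ⟨$⟩ʳ_)

    lookup-encodeˡ : ∀ σ x → lookup (proj₂ (encode σ)) x ≡ σ ⟨$⟩ˡ x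
    lookup-encodeˡ σ = lookup∘tabulate (σ ⟨$⟩ˡ_)

    encode-code : ∀ σ → IsPermutationCode (encode σ)
    encode-code σ =
      (λ y → trans (lookup-encodeʳ σ _) (trans (cong (σ ⟨$⟩ʳ_) (lookup-encodeˡ σ y)) (inverseʳ σ))) ,
      (λ x → trans (lookup-encodeˡ σ _) (trans (cong (σ ⟨$⟩ˡ_) (lookup-encodeʳ σ x)) (inverseˡ σ)))

    score-encode : ∀ {σ} → P σ → score (encode σ) ≡ suc (numCycles σ)
    score-encode {σ} Pσ = trans (score-valid (encode σ) (encode-code σ , P-resp (sym ∘ lookup-encodeʳ σ) Pσ))
                                (cong suc (numCycles-cong (lookup-encodeʳ σ)))

  numCycles-maximum : ∃ P → ∃ λ σ → P σ × (∀ τ → P τ → numCycles τ ≤ numCycles σ)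
  numCycles-maximum (σ₀ , Pσ₀) = decode best code , P-best , maximal
    where
      codes : List Code
      codes = cartesianProduct (vectors (allFin n) n) (vectors (allFin n) n)

      best : Code
      best = argmax score (encode σ₀) codes

      best-maximal : ∀ c → score c ≤ score best
      best-maximal c = All.lookup (f[xs]≤f[argmax] {f = score} (encode σ₀) codes)
        (∈-cartesianProduct⁺ (∈-vectors ∈-allFin (proj₁ c)) (∈-vectors ∈-allFin (proj₂ c)))

      valid-best : Valid best
      valid-best = valid-score best (≤-trans (s≤s z≤n)
                     (≤-trans (≤-reflexive (sym (score-encode Pσ₀))) (best-maximal (encode σ₀))))

      code : IsPermutationCode best
      code = proj₁ valid-best

      P-best : P (decode best code)
      P-best = proj₂ valid-best

      maximal : ∀ τ → P τ → numCycles τ ≤ numCycles (decode best code)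
      maximal τ Pτ = s≤s⁻¹ (begin
        suc (numCycles τ)                   ≡⟨ score-encode Pτ ⟨
        score (encode τ)                    ≤⟨ best-maximal (encode τ) ⟩
        score best                          ≡⟨ score-valid best valid-best ⟩
        suc (numCycles (decode best code))  ∎)
        where open ≤-Reasoning

Swapped : ∀ {n} → Fin n → Fin n → (Fin n → A) → (Fin n → A) → Set _
Swapped u v f f′ = f′ u ≡ f v × f′ v ≡ f u × (∀ w → w ≢ u → w ≢ v → f′ w ≡ f w)

Swapped-sym : ∀ {n} {u v : Fin n} {f f′ : Fin n → A} → Swapped u v f f′ → Swapped u v f′ f
Swapped-sym (e-u , e-v , e-other) = sym e-v , sym e-u , λ w w≢u w≢v → sym (e-other w w≢u w≢v)

transpose-other : ∀ {n} {u v w : Fin n} → w ≢ u → w ≢ v → PC.transpose u v w ≡ w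
transpose-other {u = u} {v} {w} w≢u w≢v with w ≟ u
... | yes w≡u = contradiction w≡u w≢u
... | no _ with w ≟ v
...   | yes w≡v = contradiction w≡v w≢v
...   | no _    = refl

AgreeOutside-transpose : ∀ {n} (u v : Fin n) (σ : Permutation′ n) → AgreeOutside u v σ (transpose u v ∘ₚ σ)
AgreeOutside-transpose u v σ x x≢u x≢v = cong (σ ⟨$⟩ʳ_) (transpose-other x≢u x≢v)

IsCycleCover-transpose : ∀ {n c} {u v : Fin n} {f f′ : Fin n → Fin c} → Swapped u v f f′ →
                         ∀ g σ → IsCycleCover f g σ → IsCycleCover f′ g (transpose u v ∘ₚ σ)
IsCycleCover-transpose {u = u} {v} (e-u , e-v , e-other) g σ cover w with w ≟ u
... | yes refl = trans e-u (cover v)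
... | no w≢u with w ≟ v
...   | yes refl = trans e-v (cover u)
...   | no w≢v   = trans (e-other w w≢u w≢v) (cover w)

module _ {n c : ℕ} {f g : Fin n → Fin c} where

  isCycleCover? : Decidable (IsCycleCover f g)
  isCycleCover? σ = all? λ u → f u ≟ g (σ ⟨$⟩ʳ u)

  IsCycleCover-resp : IsCycleCover f g Respects _≈_
  IsCycleCover-resp σ≈τ cover u = trans (cover u) (cong g (σ≈τ u))

  optimalCover-exists : PhiDefined f g → ∃ (IsOptimalCover f g)
  optimalCover-exists = numCycles-maximum (IsCycleCover f g) isCycleCover? (λ {σ τ} → IsCycleCover-resp {σ} {τ})

  Phi-exists : PhiDefined f g → ∃ (PhiIs f g)
  Phi-exists defined = let σ , optimal = optimalCover-exists defined in n ∸ numCycles σ , σ , optimal , refl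

lemma6 : ∀ (n c : ℕ) (ft f f' : Fin n → Fin c) →
           IsTokenPlacement ft → IsTokenPlacement f → IsTokenPlacement f' →
           Adjacent f f' → PhiDefined f ft →
           (∃ λ k' → PhiIs f' ft k') ×
           (∀ k k' → PhiIs f ft k → PhiIs f' ft k' → k ∸ 1 ≤ k')
lemma6 n c ft f f' _ _ _ (u , v , _ , swap) (σ₀ , cover₀) =
  Phi-exists {g = ft} (transpose u v ∘ₚ σ₀ , IsCycleCover-transpose swap ft σ₀ cover₀) , Phi-decrease≤1
  where
    Phi-decrease≤1 : ∀ k k' → PhiIs f ft k → PhiIs f' ft k' → k ∸ 1 ≤ k'
    Phi-decrease≤1 _ _ (σ , (_ , σ-maximal) , refl) (σ′ , (cover′ , _) , refl) = begin
      n ∸ numCycles σ ∸ 1       ≡⟨ ∸-+-assoc n (numCycles σ) 1 ⟩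
      n ∸ (numCycles σ + 1)     ≤⟨ ∸-monoʳ-≤ n (begin
        numCycles σ′                            ≤⟨ AgreeOutside⇒numCycles≤suc (AgreeOutside-transpose u v σ′) ⟩
        suc (numCycles (transpose u v ∘ₚ σ′))   ≤⟨ s≤s (σ-maximal _ (IsCycleCover-transpose (Swapped-sym swap) ft σ′ cover′)) ⟩
        suc (numCycles σ)                       ≡⟨ +-comm 1 (numCycles σ) ⟩
        numCycles σ + 1                         ∎) ⟩
      n ∸ numCycles σ′          ∎
      where open ≤-Reasoning
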